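{- Let $\Theta=(\alpha,\beta,\gamma)\in S_n\times S_n\times S_n$ be such that $\Delta(\Theta)>0$, and let $t\in\{1,\dots,n\}$ with $\mathbf{l}^\gamma_t>0$. If $r,s\in\{1,\dots,t\}$ satisfy $\mathbf{l}^\alpha_r>0$ and $\mathbf{l}^\beta_s>0$, then $$\sum_{u\in S^\beta_{r,t}} u\cdot\mathbf{l}^\beta_u\le t\cdot\mathbf{l}^\gamma_t\qquad\text{and}\qquad \sum_{u\in S^\alpha_{s,t}} u\cdot\mathbf{l}^\alpha_u\le t\cdot\mathbf{l}^\gamma_t.$$
   Context: Let $N=\{0,1,\dots,n-1\}$ and $S_n$ the symmetric group on $N$. A Latin square of order $n$ is an $n\times n$ array $L=(l_{i,j})$ with entries in $N$ in which each symbol occurs exactly once in each row and column. For $\Theta=(\alpha,\beta,\gamma)\in S_n^3$, $L^\Theta$ is the array with $(i,j)$ entry $\gamma^{ -1}(l_{\alpha(i),\beta(j)})$; $\Theta$ is an autotopism of $L$ if $L^\Theta=L$. $\Delta(\Theta)$ is the number of Latin squares of order $n$ having $\Theta$ as an autotopism. For $\delta\in S_n$, $\mathbf{l}^\delta_r$ is the number of cycles of length $r$ in its disjoint cycle decomposition (fixed points are cycles of length 1). For $r,s\in\{1,\dots,n\}$ with $\mathbf{l}^\alpha_r\cdot\mathbf{l}^\beta_s>0$, let $m=\mathrm{lcm}(r,s)$ and define $S^\gamma_{r,s}$ as the set of $t'\in\{1,\dots,m\}$ such that $\mathbf{l}^\gamma_{t'}>0$, $t'$ divides $m$, $t'$ does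 not divide any positive multiple of $r$ smaller than $m$, and $t'$ does not divide any positive multiple of $s$ smaller than $m$. Then define $S^\beta_{r,t}=\{u\in\{1,\dots,n\}:\mathbf{l}^\beta_u>0\text{ and }S^\gamma_{r,u}=\{t\}\}$ and $S^\alpha_{s,t}=\{u\in\{1,\dots,n\}:\mathbf{l}^\alpha_u>0\text{ and }S^\gamma_{u,s}=\{t\}\}$. -}

module Defs where

open import Data.Nat using (ℕ; zero; suc; _+_; _*_; _≤_; _<_; _≤ᵇ_; _<ᵇ_; _≡ᵇ_)
open import Data.Nat.Divisibility using (_∣_; _∣?_)
open import Data.Nat.LCM using (lcm)
open import Data.Fin using (Fin; toℕ)
open import Data.Fin.Permutation using (Permutation′; _⟨$⟩ʳ_; _⟨$⟩ˡ_)
open import Data.Fin.Properties using (_≟_)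
open import Data.List using (List; []; _∷_; map; upTo; filterᵇ; length; allFin; foldr)
open import Data.Nat.ListAction using (sum)
open import Data.Bool using (Bool; true; false; _∧_; not)
open import Data.Product using (Σ; _×_; ∃)
open import Relation.Binary.PropositionalEquality using (_≡_)
open import Relation.Nullary.Decidable using (⌊_⌋)

Array : ℕ → Set
Array n = Fin n → Fin n → Fin n

IsLatinSquare : ∀ {n} → Array n → Set
IsLatinSquare {n} L =
  (∀ (i k : Fin n) → Σ (Fin n) λ j → (L i j ≡ k) × (∀ j' → L i j' ≡ k → j' ≡ j)) ×
  (∀ (j k : Fin n) → Σ (Fin n) λ i → (L i j ≡ k) × (∀ i' → L i' j ≡ k → i' ≡ i))

Isotopism : ℕ → Set
Isotopism n = Permutation′ n × Permutation′ n × Permutation′ n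

_^Θ_ : ∀ {n} → Array n → Isotopism n → Array n
(L ^Θ (α Data.Product., β Data.Product., γ)) i j = γ ⟨$⟩ˡ (L (α ⟨$⟩ʳ i) (β ⟨$⟩ʳ j))

IsAutotopism : ∀ {n} → Isotopism n → Array n → Set
IsAutotopism {n} Θ L = ∀ (i j : Fin n) → (L ^Θ Θ) i j ≡ L i j

-- Δ(Θ) > 0 : some Latin square of order n has Θ as an autotopism
ΔPositive : ∀ {n} → Isotopism n → Set
ΔPositive {n} Θ = ∃ λ (L : Array n) → IsLatinSquare L × IsAutotopism Θ L

allᵇ : {A : Set} → (A → Bool) → List A → Bool
allᵇ p = foldr (λ x b → p x ∧ b) true

iter : ∀ {n} → Permutation′ n → ℕ → Fin n → Fin n
iter δ zero    x = x
iter δ (suc k) x = δ ⟨$⟩ʳ (iter δ k x)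

oneTo : ℕ → List ℕ
oneTo m = map suc (upTo m)

firstOr : ℕ → List ℕ → ℕ
firstOr d []      = d
firstOr d (k ∷ _) = k

cycleLength : ∀ {n} → Permutation′ n → Fin n → ℕ
cycleLength {n} δ x = firstOr n (filterᵇ (λ k → ⌊ iter δ k x ≟ x ⌋) (oneTo n))

isCycleRep : ∀ {n} → Permutation′ n → Fin n → Bool
isCycleRep {n} δ x = allᵇ (λ k → toℕ x ≤ᵇ toℕ (iter δ k x)) (upTo n)

-- l^δ_r : number of cycles of length r of δ (one representative per cycle)
cycleCount : ∀ {n} → Permutation′ n → ℕ → ℕ
cycleCount {n} δ r =
  length (filterᵇ (λ x → isCycleRep δ x ∧ (cycleLength δ x ≡ᵇ r)) (allFin n))

dividesNoSmallerMultiple : ℕ → ℕ → ℕ → Bool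
dividesNoSmallerMultiple t' r m =
  allᵇ (λ k → not ((k * r) <ᵇ m) ∨' not ⌊ t' ∣? (k * r) ⌋) (oneTo m)
  where
  _∨'_ : Bool → Bool → Bool
  true  ∨' _ = true
  false ∨' b = b

Sγ : ∀ {n} → Permutation′ n → ℕ → ℕ → List ℕ
Sγ γ r s = filterᵇ memb (oneTo (lcm r s))
  where
  memb : ℕ → Bool
  memb t' = (1 ≤ᵇ cycleCount γ t')
          ∧ ⌊ t' ∣? lcm r s ⌋
          ∧ dividesNoSmallerMultiple t' r (lcm r s)
          ∧ dividesNoSmallerMultiple t' s (lcm r s)

Sβ : ∀ {n} → Permutation′ n → Permutation′ n → ℕ → ℕ → List ℕ
Sβ {n} β γ r t =
  filterᵇ (λ u → (1 ≤ᵇ cycleCount β u) ∧ singletonIs t (Sγ γ r u)) (oneTo n)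
  where
  singletonIs : ℕ → List ℕ → Bool
  singletonIs t (x ∷ []) = t ≡ᵇ x
  singletonIs t _        = false

Sα : ∀ {n} → Permutation′ n → Permutation′ n → ℕ → ℕ → List ℕ
Sα {n} α γ s t =
  filterᵇ (λ u → (1 ≤ᵇ cycleCount α u) ∧ singletonIs t (Sγ γ u s)) (oneTo n)
  where
  singletonIs : ℕ → List ℕ → Bool
  singletonIs t (x ∷ []) = t ≡ᵇ x
  singletonIs t _        = false

weightedSum : ∀ {n} → Permutation′ n → List ℕ → ℕ
weightedSum δ S = sum (map (λ u → u * cycleCount δ u) S)

module Submission where

-- Idea.  Iterating L^Θ = L gives L(α^k i, β^k j) = γ^k (L i j).  From this one reads off
-- that the γ-cycle length of the entry L i j lies in S^γ_{r,s}, where r and s are the α-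
-- and β-cycle lengths of the row i and the column j.  Fix a row i in an α-cycle of length
-- r.  For every column j in a β-cycle of length u ∈ S^β_{r,t} we have S^γ_{r,u} = {t}, so
-- L i j lies in a γ-cycle of length t.  The row j ↦ L i j is injective, so the
-- Σ_{u ∈ S^β_{r,t}} u·l^β_u such columns inject into the t·l^γ_t points lying in γ-cycles
-- of length t.  Columns give the statement for α in the same way.

open import Defs
open import Data.Nat using (ℕ; zero; suc; pred; _+_; _*_; _≤_; _<_; z≤n; s≤s; NonZero; _≤ᵇ_; _<ᵇ_; _≡ᵇ_; >-nonZero)
open import Data.Nat.Properties
open import Data.Nat.Divisibility using (_∣_; _∣?_; divides; ∣-antisym; ∣⇒≤; n∣m*n; m%n≡0⇒n∣m)
open import Data.Nat.DivMod using (_%_; _/_; m≡m%n+[m/n]*n; m%n<n)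
open import Data.Nat.GCD using (gcd)
open import Data.Nat.LCM using (lcm; m∣lcm[m,n]; n∣lcm[m,n]; lcm-least; gcd*lcm)
open import Data.Nat.ListAction using (sum)
open import Data.Fin using (Fin; toℕ)
open import Data.Fin.Properties using (pigeonhole; toℕ-injective; toℕ<n) renaming (_≟_ to _≟ᶠ_)
open import Data.Fin.Permutation using (Permutation′; _⟨$⟩ʳ_; _⟨$⟩ˡ_; inverseˡ; inverseʳ)
open import Data.List using (List; []; _∷_; map; filterᵇ; length; concatMap; applyUpTo; upTo; allFin)
open import Data.List.Properties using (length-map; map-cong; length-++; length-applyUpTo; map-applyUpTo; length-removeAt′)
open import Data.List.Membership.Propositional using (_∈_; _─_; find; lose)
open import Data.List.Membership.Propositional.Properties
  using (∈-filter⁺; ∈-filter⁻; ∈-allFin; ∈-length; ∈-map⁺; ∈-map⁻; ∈-upTo⁺; ∈-applyUpTo⁺; ∈-applyUpTo⁻; ∈-concatMap⁺; ∈-concatMap⁻)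
open import Data.List.Relation.Unary.Any using (here; there)
open import Data.List.Extrema.Nat using (argmin; f[argmin]≤f[xs])
import Data.List.Relation.Unary.All as All
open import Data.List.Relation.Unary.Unique.Propositional using (Unique; []; _∷_)
import Data.List.Relation.Unary.Unique.Propositional.Properties as Unique
open import Data.Bool using (Bool; true; false; _∧_; T)
open import Data.Bool.Properties using (T?; T-∧)
open import Data.Product using (Σ; _×_; _,_; proj₁; proj₂)
open import Data.Empty using (⊥-elim)
open import Function using (_∘_; id)
open import Function.Bundles using (Equivalence)
open import Relation.Nullary using (¬_)
open import Relation.Nullary.Decidable using (⌊_⌋; toWitness; fromWitness; fromWitnessFalse)
open import Relation.Binary.PropositionalEquality
open import Relation.Binary.Definitions using (tri<; tri≈; tri>)

open Equivalence using (to; from)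

∈-filterᵇ⁺ : ∀ {A : Set} (p : A → Bool) {x : A} {xs : List A} → x ∈ xs → T (p x) → x ∈ filterᵇ p xs
∈-filterᵇ⁺ p = ∈-filter⁺ (T? ∘ p)

∈-filterᵇ⁻ : ∀ {A : Set} (p : A → Bool) {x : A} {xs : List A} → x ∈ filterᵇ p xs → x ∈ xs × T (p x)
∈-filterᵇ⁻ p = ∈-filter⁻ (T? ∘ p)

unique-filterᵇ : ∀ {A : Set} (p : A → Bool) {xs : List A} → Unique xs → Unique (filterᵇ p xs)
unique-filterᵇ p = Unique.filter⁺ (T? ∘ p)

allᵇ-intro : ∀ {A : Set} (p : A → Bool) (xs : List A) → (∀ {x} → x ∈ xs → T (p x)) → T (allᵇ p xs)
allᵇ-intro p []       h = _
allᵇ-intro p (y ∷ ys) h = from T-∧ (h (here refl) , allᵇ-intro p ys (h ∘ there))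

allᵇ-elim : ∀ {A : Set} (p : A → Bool) (xs : List A) → T (allᵇ p xs) → ∀ {x} → x ∈ xs → T (p x)
allᵇ-elim p (y ∷ ys) h (here refl) = proj₁ (to T-∧ h)
allᵇ-elim p (y ∷ ys) h (there x∈) = allᵇ-elim p ys (proj₂ (to (T-∧ {p y}) h)) x∈

∈-─ : ∀ {A : Set} {x z : A} (ys : List A) (x∈ : x ∈ ys) → z ∈ ys → z ≢ x → z ∈ ys ─ x∈
∈-─ (y ∷ ys) (here refl) (here refl) z≢x = ⊥-elim (z≢x refl)
∈-─ (y ∷ ys) (here refl) (there z∈)  z≢x = z∈
∈-─ (y ∷ ys) (there x∈)  (here refl) z≢x = here refl
∈-─ (y ∷ ys) (there x∈)  (there z∈)  z≢x = there (∈-─ ys x∈ z∈ z≢x)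

unique-⊆⇒length≤ : ∀ {A : Set} {xs ys : List A} → Unique xs → (∀ {z} → z ∈ xs → z ∈ ys) → length xs ≤ length ys
unique-⊆⇒length≤ {xs = []}     _            _   = z≤n
unique-⊆⇒length≤ {xs = x ∷ xs} {ys} (x∉ ∷ u) sub =
  subst (suc (length xs) ≤_) (sym (length-removeAt′ ys _))
    (s≤s (unique-⊆⇒length≤ u (λ z∈ → ∈-─ ys x∈ys (sub (there z∈)) (λ z≡x → All.lookup x∉ z∈ (sym z≡x)))))
  where
  x∈ys : x ∈ ys
  x∈ys = sub (here refl)

unique-≈⇒length≡ : ∀ {A : Set} {xs ys : List A} → Unique xs → Unique ys →
  (∀ {z} → z ∈ xs → z ∈ ys) → (∀ {z} → z ∈ ys → z ∈ xs) → length xs ≡ length ys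
unique-≈⇒length≡ uxs uys xs⊆ys ys⊆xs = ≤-antisym (unique-⊆⇒length≤ uxs xs⊆ys) (unique-⊆⇒length≤ uys ys⊆xs)

unique-concatMap : ∀ {A B : Set} (f : B → List A) (S : List B) → Unique S → (∀ {u} → u ∈ S → Unique (f u)) →
  (∀ {u v x} → u ∈ S → v ∈ S → x ∈ f u → x ∈ f v → u ≡ v) → Unique (concatMap f S)
unique-concatMap f []      _          _    _        = []
unique-concatMap f (u ∷ S) (u∉ ∷ uS) uniq disjoint =
  Unique.++⁺ (uniq (here refl)) (unique-concatMap f S uS (uniq ∘ there) (λ u∈ v∈ → disjoint (there u∈) (there v∈)))
    λ (x∈fu , x∈rest) → let (v , v∈ , x∈fv) = find (∈-concatMap⁻ f {xs = S} x∈rest) in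
      All.lookup u∉ v∈ (disjoint (here refl) (there v∈) x∈fu x∈fv)

length-concatMap : ∀ {A B : Set} (f : B → List A) (S : List B) → length (concatMap f S) ≡ sum (map (length ∘ f) S)
length-concatMap f []      = refl
length-concatMap f (u ∷ S) = trans (length-++ (f u)) (cong (length (f u) +_) (length-concatMap f S))

first-filtered : (p : ℕ → Bool) (h : ℕ → ℕ) (d m i : ℕ) → i < m → T (p (h i)) →
  Σ ℕ λ i₀ → i₀ ≤ i × firstOr d (filterᵇ p (applyUpTo h m)) ≡ h i₀ × T (p (h i₀)) × (∀ j → j < i₀ → ¬ T (p (h j)))
first-filtered p h d (suc m) i i<m phi with p (h 0) in eq
... | true  = 0 , z≤n , refl , subst T (sym eq) _ , λ _ ()
... | false with i
...   | zero   = ⊥-elim (subst T eq phi)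
...   | suc i′ with first-filtered p (h ∘ suc) d m i′ (≤-pred i<m) phi
...     | (i₀ , i₀≤i′ , first≡ , pi₀ , earlier) = suc i₀ , s≤s i₀≤i′ , first≡ , pi₀ , earlier′
  where
  earlier′ : ∀ j → j < suc i₀ → ¬ T (p (h j))
  earlier′ zero    _         ph0 = subst T eq ph0
  earlier′ (suc j) (s≤s j<i₀) = earlier j j<i₀

sum-map-const : ∀ {A : Set} (f : A → ℕ) (u : ℕ) (xs : List A) → (∀ x → f x ≡ u) → sum (map f xs) ≡ u * length xs
sum-map-const f u []       _  = sym (*-zeroʳ u)
sum-map-const f u (x ∷ xs) fu = trans (cong₂ _+_ (fu x) (sum-map-const f u xs fu)) (sym (*-suc u (length xs)))

-- (2) The cycle structure of a permutation δ of Fin n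

module Cycles {n : ℕ} (δ : Permutation′ n) where

  iter-+ : ∀ a b x → iter δ (a + b) x ≡ iter δ a (iter δ b x)
  iter-+ zero    b x = refl
  iter-+ (suc a) b x = cong (δ ⟨$⟩ʳ_) (iter-+ a b x)

  iter-comm : ∀ a b x → iter δ a (iter δ b x) ≡ iter δ b (iter δ a x)
  iter-comm a b x = trans (sym (iter-+ a b x)) (trans (cong (λ k → iter δ k x) (+-comm a b)) (iter-+ b a x))

  iter-injective : ∀ k {x y} → iter δ k x ≡ iter δ k y → x ≡ y
  iter-injective zero    eq = eq
  iter-injective (suc k) eq = iter-injective k (trans (sym (inverseˡ δ)) (trans (cong (δ ⟨$⟩ˡ_) eq) (inverseˡ δ)))

  iter-cancel : ∀ a k x → iter δ a x ≡ iter δ (a + k) x → iter δ k x ≡ x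
  iter-cancel a k x eq = iter-injective a (trans (sym (iter-+ a k x)) (sym eq))

  iter-multiple : ∀ k x → iter δ k x ≡ x → ∀ q → iter δ (q * k) x ≡ x
  iter-multiple k x ret zero    = refl
  iter-multiple k x ret (suc q) = trans (iter-+ k (q * k) x) (trans (cong (iter δ k) (iter-multiple k x ret q)) ret)

  iter-% : ∀ k x → iter δ k x ≡ x → .{{_ : NonZero k}} → ∀ m → iter δ m x ≡ iter δ (m % k) x
  iter-% k x ret m = begin
    iter δ m x                                ≡⟨ cong (λ e → iter δ e x) (m≡m%n+[m/n]*n m k) ⟩
    iter δ (m % k + (m / k) * k) x            ≡⟨ iter-+ (m % k) ((m / k) * k) x ⟩
    iter δ (m % k) (iter δ ((m / k) * k) x)   ≡⟨ cong (iter δ (m % k)) (iter-multiple k x ret (m / k)) ⟩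
    iter δ (m % k) x                          ∎
    where open ≡-Reasoning

  -- Pigeonhole on x, δx, …, δⁿx: every point returns within n steps.
  return-exists : ∀ x → Σ ℕ λ i → i < n × iter δ (suc i) x ≡ x
  return-exists x with pigeonhole (n<1+n n) (λ (i : Fin (suc n)) → iter δ (toℕ i) x)
  ... | (i , j , i<j , eq) with m≤n⇒∃[o]m+o≡n i<j
  ...   | (o , i+1+o≡j) = o , o<n , iter-cancel (toℕ i) (suc o) x (trans eq (cong (λ k → iter δ k x) j≡))
    where
    j≡ : toℕ j ≡ toℕ i + suc o
    j≡ = trans (sym i+1+o≡j) (sym (+-suc (toℕ i) o))
    o<n : o < n
    o<n = ≤-trans (m≤n+m (suc o) (toℕ i)) (subst (_≤ n) j≡ (≤-pred (toℕ<n j)))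

  len : Fin n → ℕ
  len = cycleLength δ

  returns : Fin n → ℕ → Bool
  returns x k = ⌊ iter δ k x ≟ᶠ x ⌋

  cycleLength-spec : ∀ x → Σ ℕ λ i₀ → len x ≡ suc i₀ × i₀ < n × iter δ (suc i₀) x ≡ x
                                    × (∀ j → j < i₀ → iter δ (suc j) x ≢ x)
  cycleLength-spec x with return-exists x
  ... | (i , i<n , ret) with first-filtered (returns x) suc n n i i<n (fromWitness ret)
  ...   | (i₀ , i₀≤i , first≡ , ret₀ , earlier) =
    i₀ , trans (cong (firstOr n ∘ filterᵇ (returns x)) (map-applyUpTo id suc n)) first≡ ,
    ≤-<-trans i₀≤i i<n , toWitness ret₀ , λ j j<i₀ retj → earlier j j<i₀ (fromWitness retj)

  len-pos : ∀ x → 0 < len x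
  len-pos x with cycleLength-spec x
  ... | (i₀ , len≡ , _) = subst (0 <_) (sym len≡) (s≤s z≤n)

  instance
    len-nonZero : ∀ {x} → NonZero (len x)
    len-nonZero {x} = >-nonZero (len-pos x)

  len≤n : ∀ x → len x ≤ n
  len≤n x with cycleLength-spec x
  ... | (i₀ , len≡ , i₀<n , _) = subst (_≤ n) (sym len≡) i₀<n

  len-return : ∀ x → iter δ (len x) x ≡ x
  len-return x with cycleLength-spec x
  ... | (i₀ , len≡ , _ , ret , _) = subst (λ k → iter δ k x ≡ x) (sym len≡) ret

  len-minimal : ∀ x k → 0 < k → k < len x → iter δ k x ≢ x
  len-minimal x (suc j) _ j<len with cycleLength-spec x
  ... | (i₀ , len≡ , _ , _ , earlier) = earlier j (≤-pred (subst (suc j <_) len≡ j<len))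

  short-return⇒0 : ∀ x j → j < len x → iter δ j x ≡ x → j ≡ 0
  short-return⇒0 x zero    _     _   = refl
  short-return⇒0 x (suc j) j<len ret = ⊥-elim (len-minimal x (suc j) (s≤s z≤n) j<len ret)

  return⇒len∣ : ∀ x k → iter δ k x ≡ x → len x ∣ k
  return⇒len∣ x k ret = m%n≡0⇒n∣m k (len x) (short-return⇒0 x (k % len x) (m%n<n k (len x))
    (trans (sym (iter-% (len x) x (len-return x) k)) ret))

  len∣⇒return : ∀ x k → len x ∣ k → iter δ k x ≡ x
  len∣⇒return x k (divides q refl) = iter-multiple (len x) x (len-return x) q

  no-early-repeat : ∀ x {a b} → a < b → b < len x → iter δ a x ≢ iter δ b x
  no-early-repeat x {a} a<b b< eq with m≤n⇒∃[o]m+o≡n a<b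
  ... | (o , refl) = <⇒≱ b< (≤-trans (∣⇒≤ (return⇒len∣ x (suc o) ret)) (s≤s (m≤n+m o a)))
    where
    ret : iter δ (suc o) x ≡ x
    ret = iter-cancel a (suc o) x (trans eq (cong (λ k → iter δ k x) (sym (+-suc a o))))

  orbit-injective : ∀ x {a b} → a < len x → b < len x → iter δ a x ≡ iter δ b x → a ≡ b
  orbit-injective x {a} {b} a< b< eq with <-cmp a b
  ... | tri< a<b _ _ = ⊥-elim (no-early-repeat x a<b b< eq)
  ... | tri≈ _ a≡b _ = a≡b
  ... | tri> _ _ b<a = ⊥-elim (no-early-repeat x b<a a< (sym eq))

  _∼_ : Fin n → Fin n → Set
  x ∼ y = Σ ℕ λ c → iter δ c x ≡ y

  ∼-sym : ∀ {x y} → x ∼ y → y ∼ x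
  ∼-sym {x} (c , refl) = c * pred (len x) , (begin
    iter δ (c * pred (len x)) (iter δ c x)   ≡⟨ sym (iter-+ (c * pred (len x)) c x) ⟩
    iter δ (c * pred (len x) + c) x          ≡⟨ cong (λ k → iter δ k x) c*len≡ ⟩
    iter δ (c * len x) x                     ≡⟨ len∣⇒return x (c * len x) (n∣m*n c) ⟩
    x                                        ∎)
    where
    open ≡-Reasoning
    c*len≡ : c * pred (len x) + c ≡ c * len x
    c*len≡ = trans (+-comm _ c) (trans (sym (*-suc c (pred (len x)))) (cong (c *_) (suc-pred (len x))))

  ∼-trans : ∀ {x y z} → x ∼ y → y ∼ z → x ∼ z
  ∼-trans {x} (c , refl) (d , refl) = d + c , iter-+ d c x

  ∼⇒len∣ : ∀ {x y} → x ∼ y → len y ∣ len x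
  ∼⇒len∣ {x} (c , refl) = return⇒len∣ (iter δ c x) (len x) (trans (iter-comm (len x) c x) (cong (iter δ c) (len-return x)))

  ∼⇒len≡ : ∀ {x y} → x ∼ y → len x ≡ len y
  ∼⇒len≡ x∼y = ∣-antisym (∼⇒len∣ (∼-sym x∼y)) (∼⇒len∣ x∼y)

  isRep : Fin n → Bool
  isRep = isCycleRep δ

  rep-minimal : ∀ {ρ} → T (isRep ρ) → ∀ k → toℕ ρ ≤ toℕ (iter δ k ρ)
  rep-minimal {ρ} rep k = subst (λ y → toℕ ρ ≤ toℕ y) (sym (iter-% (len ρ) ρ (len-return ρ) k))
    (≤ᵇ⇒≤ _ _ (allᵇ-elim _ (upTo n) rep (∈-upTo⁺ (<-≤-trans (m%n<n k (len ρ)) (len≤n ρ)))))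

  rep-unique : ∀ {ρ ρ′} → T (isRep ρ) → T (isRep ρ′) → ρ ∼ ρ′ → ρ ≡ ρ′
  rep-unique {ρ} {ρ′} rep rep′ ρ∼ρ′@(c , refl) with ∼-sym ρ∼ρ′
  ... | (c′ , back) = toℕ-injective (≤-antisym (rep-minimal rep c)
                        (subst (λ y → toℕ (iter δ c ρ) ≤ toℕ y) back (rep-minimal rep′ c′)))

  -- Every cycle has a representative: the point of least index among δᵏx, k < n.
  rep-exists : ∀ x → Σ (Fin n) λ ρ → T (isRep ρ) × ρ ∼ x
  rep-exists x = ρ , allᵇ-intro _ (upTo n) (λ {k} _ → ≤⇒≤ᵇ (ρ-minimal k)) , ∼-sym (k₀ , refl)
    where
    index : ℕ → ℕ
    index k = toℕ (iter δ k x)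
    k₀ : ℕ
    k₀ = argmin index 0 (upTo n)
    ρ : Fin n
    ρ = iter δ k₀ x
    ρ-minimal : ∀ k → toℕ ρ ≤ toℕ (iter δ k ρ)
    ρ-minimal k = subst (λ y → toℕ ρ ≤ toℕ y)
      (sym (trans (sym (iter-+ k k₀ x)) (iter-% (len x) x (len-return x) (k + k₀))))
      (All.lookup (f[argmin]≤f[xs] {f = index} 0 (upTo n)) (∈-upTo⁺ (<-≤-trans (m%n<n (k + k₀) (len x)) (len≤n x))))

  -- The points in cycles of length u are exactly the points of the cycles
  -- δ⁰ρ, …, δ^{u-1}ρ of the representatives ρ of length u; there are l_u = cycleCount δ u
  -- such representatives, so there are u · l_u such points.
  isRepOfLength : ℕ → Fin n → Bool
  isRepOfLength u x = isRep x ∧ (len x ≡ᵇ u)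

  pointsOfLength : ℕ → List (Fin n)
  pointsOfLength u = filterᵇ (λ x → len x ≡ᵇ u) (allFin n)

  repsOfLength : ℕ → List (Fin n)
  repsOfLength u = filterᵇ (isRepOfLength u) (allFin n)

  cycleFrom : ℕ → Fin n → List (Fin n)
  cycleFrom u ρ = applyUpTo (λ a → iter δ a ρ) u

  ∈-pointsOfLength⁺ : ∀ {u x} → len x ≡ u → x ∈ pointsOfLength u
  ∈-pointsOfLength⁺ {u} {x} len≡ = ∈-filterᵇ⁺ _ (∈-allFin x) (≡⇒≡ᵇ (len x) u len≡)

  ∈-pointsOfLength⁻ : ∀ {u x} → x ∈ pointsOfLength u → len x ≡ u
  ∈-pointsOfLength⁻ {u} {x} x∈ = ≡ᵇ⇒≡ (len x) u (proj₂ (∈-filterᵇ⁻ (λ y → len y ≡ᵇ u) {xs = allFin n} x∈))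

  ∈-repsOfLength⁺ : ∀ {u ρ} → T (isRep ρ) → len ρ ≡ u → ρ ∈ repsOfLength u
  ∈-repsOfLength⁺ {u} {ρ} rep len≡ = ∈-filterᵇ⁺ _ (∈-allFin ρ) (from T-∧ (rep , ≡⇒≡ᵇ (len ρ) u len≡))

  ∈-repsOfLength⁻ : ∀ {u ρ} → ρ ∈ repsOfLength u → T (isRep ρ) × len ρ ≡ u
  ∈-repsOfLength⁻ {u} {ρ} ρ∈ =
    let (rep , len≡) = to T-∧ (proj₂ (∈-filterᵇ⁻ (isRepOfLength u) {xs = allFin n} ρ∈))
    in rep , ≡ᵇ⇒≡ (len ρ) u len≡

  cyclesOfLength : ℕ → List (Fin n)
  cyclesOfLength u = concatMap (cycleFrom u) (repsOfLength u)

  cycles⊆points : ∀ u {x} → x ∈ cyclesOfLength u → x ∈ pointsOfLength u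
  cycles⊆points u x∈ =
    let (ρ , ρ∈ , x∈cycle) = find (∈-concatMap⁻ (cycleFrom u) {xs = repsOfLength u} x∈)
        (a , _ , x≡)       = ∈-applyUpTo⁻ (λ a → iter δ a ρ) x∈cycle
    in ∈-pointsOfLength⁺ (trans (sym (∼⇒len≡ (a , sym x≡))) (proj₂ (∈-repsOfLength⁻ ρ∈)))

  points⊆cycles : ∀ u {x} → x ∈ pointsOfLength u → x ∈ cyclesOfLength u
  points⊆cycles u {x} x∈ =
    let (ρ , rep , ρ∼x) = rep-exists x
        (c , ρc≡x)      = ρ∼x
        len≡ : len ρ ≡ u
        len≡ = trans (∼⇒len≡ ρ∼x) (∈-pointsOfLength⁻ x∈)
        x≡ : iter δ (c % len ρ) ρ ≡ x
        x≡ = trans (sym (iter-% (len ρ) ρ (len-return ρ) c)) ρc≡x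
        c%<u : c % len ρ < u
        c%<u = subst (c % len ρ <_) len≡ (m%n<n c (len ρ))
    in ∈-concatMap⁺ (cycleFrom u) (lose (∈-repsOfLength⁺ rep len≡)
         (subst (_∈ cycleFrom u ρ) x≡ (∈-applyUpTo⁺ (λ a → iter δ a ρ) c%<u)))

  unique-cyclesOfLength : ∀ u → Unique (cyclesOfLength u)
  unique-cyclesOfLength u = unique-concatMap (cycleFrom u) (repsOfLength u)
    (unique-filterᵇ (isRepOfLength u) (Unique.allFin⁺ n)) unique-cycle disjoint-cycles
    where
    unique-cycle : ∀ {ρ} → ρ ∈ repsOfLength u → Unique (cycleFrom u ρ)
    unique-cycle {ρ} ρ∈ = Unique.applyUpTo⁺₁ (λ a → iter δ a ρ) u λ a<b b<u →
      <⇒≢ a<b ∘ orbit-injective ρ (<-trans a<b (below-len b<u)) (below-len b<u)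
      where
      below-len : ∀ {b} → b < u → b < len ρ
      below-len = subst (_ <_) (sym (proj₂ (∈-repsOfLength⁻ ρ∈)))
    disjoint-cycles : ∀ {ρ ρ′ x} → ρ ∈ repsOfLength u → ρ′ ∈ repsOfLength u →
                      x ∈ cycleFrom u ρ → x ∈ cycleFrom u ρ′ → ρ ≡ ρ′
    disjoint-cycles {ρ} {ρ′} ρ∈ ρ′∈ x∈ x∈′ =
      let (a , _ , x≡) = ∈-applyUpTo⁻ (λ a → iter δ a ρ) x∈
          (b , _ , x≡′) = ∈-applyUpTo⁻ (λ b → iter δ b ρ′) x∈′
      in rep-unique (proj₁ (∈-repsOfLength⁻ ρ∈)) (proj₁ (∈-repsOfLength⁻ ρ′∈))
           (∼-trans (a , trans (sym x≡) x≡′) (∼-sym (b , refl)))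

  points-count : ∀ u → length (pointsOfLength u) ≡ u * cycleCount δ u
  points-count u = begin
    length (pointsOfLength u)                         ≡⟨ unique-≈⇒length≡ (unique-filterᵇ (λ x → len x ≡ᵇ u) (Unique.allFin⁺ n))
                                                           (unique-cyclesOfLength u) (points⊆cycles u) (cycles⊆points u) ⟩
    length (cyclesOfLength u)                         ≡⟨ length-concatMap (cycleFrom u) (repsOfLength u) ⟩
    sum (map (length ∘ cycleFrom u) (repsOfLength u)) ≡⟨ sum-map-const (length ∘ cycleFrom u) u (repsOfLength u) (λ ρ → length-applyUpTo _ u) ⟩
    u * cycleCount δ u                                ∎
    where open ≡-Reasoning

  cycleCount-len-pos : ∀ x → 0 < cycleCount δ (len x)
  cycleCount-len-pos x =
    let (ρ , rep , ρ∼x) = rep-exists x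
    in ∈-length (∈-repsOfLength⁺ rep (∼⇒len≡ ρ∼x))

  point-of-length : ∀ {u} → 0 < cycleCount δ u → Σ (Fin n) λ x → len x ≡ u
  point-of-length {u} 0<l = point (repsOfLength u) 0<l (λ ρ∈ → proj₂ (∈-repsOfLength⁻ ρ∈))
    where
    point : (xs : List (Fin n)) → 0 < length xs → (∀ {x} → x ∈ xs → len x ≡ u) → Σ (Fin n) λ x → len x ≡ u
    point (x ∷ _) _ lens = x , lens (here refl)

  pointsWithLengthIn : List ℕ → List (Fin n)
  pointsWithLengthIn S = concatMap pointsOfLength S

  ∈-pointsWithLengthIn⁻ : ∀ {S x} → x ∈ pointsWithLengthIn S → len x ∈ S
  ∈-pointsWithLengthIn⁻ {S} x∈ =
    let (u , u∈ , x∈u) = find (∈-concatMap⁻ pointsOfLength {xs = S} x∈)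
    in subst (_∈ S) (sym (∈-pointsOfLength⁻ x∈u)) u∈

  unique-pointsWithLengthIn : ∀ {S} → Unique S → Unique (pointsWithLengthIn S)
  unique-pointsWithLengthIn {S} uniqueS = unique-concatMap pointsOfLength S uniqueS
    (λ {u} _ → unique-filterᵇ (λ x → len x ≡ᵇ u) (Unique.allFin⁺ n))
    (λ _ _ x∈u x∈v → trans (sym (∈-pointsOfLength⁻ x∈u)) (∈-pointsOfLength⁻ x∈v))

  length-pointsWithLengthIn : ∀ S → length (pointsWithLengthIn S) ≡ weightedSum δ S
  length-pointsWithLengthIn S = trans (length-concatMap pointsOfLength S) (cong sum (map-cong points-count S))

injection-bound : ∀ {m n} (δ : Permutation′ m) (γ : Permutation′ n) (g : Fin m → Fin n) →
  (∀ {x y} → g x ≡ g y → x ≡ y) → (S : List ℕ) → Unique S → (t : ℕ) →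
  (∀ x → cycleLength δ x ∈ S → cycleLength γ (g x) ≡ t) → weightedSum δ S ≤ t * cycleCount γ t
injection-bound δ γ g g-injective S uniqueS t maps-to-t = begin
  weightedSum δ S                     ≡⟨ sym (D.length-pointsWithLengthIn S) ⟩
  length (D.pointsWithLengthIn S)     ≡⟨ sym (length-map g (D.pointsWithLengthIn S)) ⟩
  length (map g (D.pointsWithLengthIn S))
    ≤⟨ unique-⊆⇒length≤ (Unique.map⁺ g-injective (D.unique-pointsWithLengthIn uniqueS)) image⊆ ⟩
  length (G.pointsOfLength t)         ≡⟨ G.points-count t ⟩
  t * cycleCount γ t                  ∎
  where
  open ≤-Reasoning
  module D = Cycles δ
  module G = Cycles γ
  image⊆ : ∀ {z} → z ∈ map g (D.pointsWithLengthIn S) → z ∈ G.pointsOfLength t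
  image⊆ z∈ = let (x , x∈ , z≡) = ∈-map⁻ g z∈
              in subst (_∈ G.pointsOfLength t) (sym z≡) (G.∈-pointsOfLength⁺ (maps-to-t x (D.∈-pointsWithLengthIn⁻ x∈)))

-- (3) Membership in the sets S^γ, S^β and S^α

∈-oneTo : ∀ {v m} → 0 < v → v ≤ m → v ∈ oneTo m
∈-oneTo {suc v} _ v<m = ∈-map⁺ suc (∈-upTo⁺ v<m)

∈-oneTo⁻ : ∀ {v m} → v ∈ oneTo m → 0 < v
∈-oneTo⁻ v∈ = let (_ , _ , v≡) = ∈-map⁻ suc v∈ in subst (0 <_) (sym v≡) (s≤s z≤n)

unique-oneTo : ∀ m → Unique (oneTo m)
unique-oneTo m = Unique.map⁺ suc-injective (Unique.upTo⁺ m)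

-- lcm(a, b) > 0 for a, b > 0, since gcd(a, b)·lcm(a, b) = a·b.
lcm-pos : ∀ {a b} → 0 < a → 0 < b → 0 < lcm a b
lcm-pos {suc a} {suc b} _ _ = n≢0⇒n>0 λ lcm≡0 → 1+n≢0 (begin
  suc a * suc b                             ≡⟨ sym (gcd*lcm (suc a) (suc b)) ⟩
  gcd (suc a) (suc b) * lcm (suc a) (suc b) ≡⟨ cong (gcd (suc a) (suc b) *_) lcm≡0 ⟩
  gcd (suc a) (suc b) * 0                   ≡⟨ *-zeroʳ (gcd (suc a) (suc b)) ⟩
  0                                         ∎)
  where open ≡-Reasoning

-- The Boolean tested at each k is local to Defs, so the
-- conclusion of noSmallerMultiple-at is the instance inferred from its single use.
mutual
  noSmallerMultiple : ∀ {t′ a m} → 0 < a → (∀ c → a ∣ c → t′ ∣ c → m ∣ c) →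
                      T (dividesNoSmallerMultiple t′ a m)
  noSmallerMultiple {m = m} 0<a m∣common = allᵇ-intro _ (oneTo m) (noSmallerMultiple-at 0<a m∣common _)

  noSmallerMultiple-at : ∀ {t′ a m} → 0 < a → (∀ c → a ∣ c → t′ ∣ c → m ∣ c) → ∀ k → k ∈ oneTo m → _
  noSmallerMultiple-at {a = a} {m = m} 0<a m∣common k k∈ with (k * a) <ᵇ m in ka<m
  ... | false = _
  ... | true  = fromWitnessFalse λ t′∣ka →
    <⇒≱ (<ᵇ⇒< (k * a) m (subst T (sym ka<m) _))
        (∣⇒≤ {{>-nonZero (*-mono-< (∈-oneTo⁻ k∈) 0<a)}} (m∣common (k * a) (n∣m*n k) t′∣ka))

∈-Sγ : ∀ {n} (γ : Permutation′ n) {r s t′} → 0 < r → 0 < s → 0 < t′ → 0 < cycleCount γ t′ →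
  t′ ∣ lcm r s → (∀ c → r ∣ c → t′ ∣ c → s ∣ c) → (∀ c → s ∣ c → t′ ∣ c → r ∣ c) → t′ ∈ Sγ γ r s
∈-Sγ γ {r} {s} {t′} 0<r 0<s 0<t′ 0<l t′∣lcm r-forces-s s-forces-r =
  ∈-filterᵇ⁺ _ (∈-oneTo 0<t′ (∣⇒≤ {{>-nonZero (lcm-pos 0<r 0<s)}} t′∣lcm))
    (from (T-∧ {1 ≤ᵇ cycleCount γ t′}) (≤⇒≤ᵇ 0<l , from (T-∧ {⌊ t′ ∣? lcm r s ⌋}) (fromWitness t′∣lcm ,
      from (T-∧ {dividesNoSmallerMultiple t′ r (lcm r s)} {dividesNoSmallerMultiple t′ s (lcm r s)})
      ( noSmallerMultiple 0<r (λ c r∣c t′∣c → lcm-least r∣c (r-forces-s c r∣c t′∣c))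
      , noSmallerMultiple 0<s (λ c s∣c t′∣c → lcm-least (s-forces-r c s∣c t′∣c) s∣c)))))

Sβ-forces : ∀ {n} (β γ : Permutation′ n) {r t u y} → u ∈ Sβ β γ r t → y ∈ Sγ γ r u → y ≡ t
Sβ-forces {n} β γ {r} {t} {u} u∈ y∈
  with Sγ γ r u | proj₂ (to (T-∧ {1 ≤ᵇ cycleCount β u}) (proj₂ (∈-filterᵇ⁻ _ {xs = oneTo n} u∈)))
Sβ-forces β γ {t = t} _ (here refl) | z ∷ []    | t≡z = sym (≡ᵇ⇒≡ t z t≡z)
Sβ-forces β γ         _ (there ())  | z ∷ []    | _
Sβ-forces β γ         _ _           | []        | ()
Sβ-forces β γ         _ _           | _ ∷ _ ∷ _ | ()

Sα-forces : ∀ {n} (α γ : Permutation′ n) {s t u y} → u ∈ Sα α γ s t → y ∈ Sγ γ u s → y ≡ t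
Sα-forces {n} α γ {s} {t} {u} u∈ y∈
  with Sγ γ u s | proj₂ (to (T-∧ {1 ≤ᵇ cycleCount α u}) (proj₂ (∈-filterᵇ⁻ _ {xs = oneTo n} u∈)))
Sα-forces α γ {t = t} _ (here refl) | z ∷ []    | t≡z = sym (≡ᵇ⇒≡ t z t≡z)
Sα-forces α γ         _ (there ())  | z ∷ []    | _
Sα-forces α γ         _ _           | []        | ()
Sα-forces α γ         _ _           | _ ∷ _ ∷ _ | ()

-- (4) Latin squares with the autotopism (α, β, γ)

module AutotopicLatinSquare {n : ℕ} (α β γ : Permutation′ n) (L : Array n)
                            (latin : IsLatinSquare L) (autotopism : IsAutotopism (α , β , γ) L) where
  private
    module A = Cycles α
    module B = Cycles β
    module G = Cycles γ

  autotopism-power : ∀ k i j → L (iter α k i) (iter β k j) ≡ iter γ k (L i j)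
  autotopism-power zero    i j = refl
  autotopism-power (suc k) i j = begin
    L (α ⟨$⟩ʳ iter α k i) (β ⟨$⟩ʳ iter β k j)                ≡⟨ sym (inverseʳ γ) ⟩
    γ ⟨$⟩ʳ (γ ⟨$⟩ˡ L (α ⟨$⟩ʳ iter α k i) (β ⟨$⟩ʳ iter β k j)) ≡⟨ cong (γ ⟨$⟩ʳ_) (autotopism (iter α k i) (iter β k j)) ⟩
    γ ⟨$⟩ʳ L (iter α k i) (iter β k j)                         ≡⟨ cong (γ ⟨$⟩ʳ_) (autotopism-power k i j) ⟩
    γ ⟨$⟩ʳ iter γ k (L i j)                                    ∎
    where open ≡-Reasoning

  row-injective : ∀ i {j j′} → L i j ≡ L i j′ → j ≡ j′
  row-injective i {j} {j′} eq = let (_ , _ , unique) = proj₁ latin i (L i j) in trans (unique j refl) (sym (unique j′ (sym eq)))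

  column-injective : ∀ j {i i′} → L i j ≡ L i′ j → i ≡ i′
  column-injective j {i} {i′} eq = let (_ , _ , unique) = proj₂ latin j (L i j) in trans (unique i refl) (sym (unique i′ (sym eq)))

  -- If c is a period of the row i and of the entry L i j, it is a period of the column j
  -- (and symmetrically), because the row is injective.
  row-forces-column : ∀ i j c → A.len i ∣ c → G.len (L i j) ∣ c → B.len j ∣ c
  row-forces-column i j c i∣c Lij∣c = B.return⇒len∣ j c (row-injective i (begin
    L i (iter β c j)               ≡⟨ cong (λ i′ → L i′ (iter β c j)) (sym (A.len∣⇒return i c i∣c)) ⟩
    L (iter α c i) (iter β c j)    ≡⟨ autotopism-power c i j ⟩
    iter γ c (L i j)               ≡⟨ G.len∣⇒return (L i j) c Lij∣c ⟩
    L i j                          ∎))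
    where open ≡-Reasoning

  column-forces-row : ∀ i j c → B.len j ∣ c → G.len (L i j) ∣ c → A.len i ∣ c
  column-forces-row i j c j∣c Lij∣c = A.return⇒len∣ i c (column-injective j (begin
    L (iter α c i) j               ≡⟨ cong (L (iter α c i)) (sym (B.len∣⇒return j c j∣c)) ⟩
    L (iter α c i) (iter β c j)    ≡⟨ autotopism-power c i j ⟩
    iter γ c (L i j)               ≡⟨ G.len∣⇒return (L i j) c Lij∣c ⟩
    L i j                          ∎))
    where open ≡-Reasoning

  entry-period : ∀ i j → G.len (L i j) ∣ lcm (A.len i) (B.len j)
  entry-period i j = G.return⇒len∣ (L i j) m (begin
    iter γ m (L i j)                ≡⟨ sym (autotopism-power m i j) ⟩
    L (iter α m i) (iter β m j)     ≡⟨ cong₂ L (A.len∣⇒return i m (m∣lcm[m,n] (A.len i) (B.len j)))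
                                                        (B.len∣⇒return j m (n∣lcm[m,n] (A.len i) (B.len j))) ⟩
    L i j                           ∎)
    where
    open ≡-Reasoning
    m : ℕ
    m = lcm (A.len i) (B.len j)

  entry-in-Sγ : ∀ i j → G.len (L i j) ∈ Sγ γ (A.len i) (B.len j)
  entry-in-Sγ i j = ∈-Sγ γ (A.len-pos i) (B.len-pos j) (G.len-pos (L i j)) (G.cycleCount-len-pos (L i j))
    (entry-period i j) (row-forces-column i j) (column-forces-row i j)

  row-bound : ∀ {r} → 0 < cycleCount α r → ∀ t → weightedSum β (Sβ β γ r t) ≤ t * cycleCount γ t
  row-bound {r} 0<l t =
    let (i , len-i≡r) = A.point-of-length 0<l
    in injection-bound β γ (L i) (row-injective i) (Sβ β γ r t) (unique-filterᵇ _ (unique-oneTo n)) t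
         λ j len-j∈ → Sβ-forces β γ {r = r} len-j∈ (subst (λ r → G.len (L i j) ∈ Sγ γ r (B.len j)) len-i≡r (entry-in-Sγ i j))

  column-bound : ∀ {s} → 0 < cycleCount β s → ∀ t → weightedSum α (Sα α γ s t) ≤ t * cycleCount γ t
  column-bound {s} 0<l t =
    let (j , len-j≡s) = B.point-of-length 0<l
    in injection-bound α γ (λ i → L i j) (column-injective j) (Sα α γ s t) (unique-filterᵇ _ (unique-oneTo n)) t
         λ i len-i∈ → Sα-forces α γ {s = s} len-i∈ (subst (λ s → G.len (L i j) ∈ Sγ γ (A.len i) s) len-j≡s (entry-in-Sγ i j))

-- (5) The theorem.  Only Δ(Θ) > 0, l^α_r > 0 and l^β_s > 0 are used; the inequalities hold
-- without the size conditions on r, s and t.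

theorem4 : (n : ℕ) (α β γ : Permutation′ n) → ΔPositive (α , β , γ) →
    (t : ℕ) → 1 ≤ t → t ≤ n → 0 < cycleCount γ t →
    (r s : ℕ) → 1 ≤ r → r ≤ t → 1 ≤ s → s ≤ t →
    0 < cycleCount α r → 0 < cycleCount β s →
    (weightedSum β (Sβ β γ r t) ≤ t * cycleCount γ t)
    × (weightedSum α (Sα α γ s t) ≤ t * cycleCount γ t)
theorem4 n α β γ (L , latin , autotopism) t _ _ _ r s _ _ _ _ 0<lα 0<lβ =
  row-bound 0<lα t , column-bound 0<lβ t
  where open AutotopicLatinSquare α β γ L latin autotopism
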